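{- If $M(A)$ and $N(B)$ are matched, then the set of loops of $M\mathbin{\Join} N$ equals $\mathrm{loops}(M)\cup\mathrm{loops}(N)$ if $A-B\subseteq\mathrm{loops}(M)$, and equals $\mathrm{loops}(M)$ otherwise; and the set of isthmuses of $M\mathbin{\Join} N$ equals $\mathrm{isthm}(M)\cup\mathrm{isthm}(N)$ if $B-A\subseteq\mathrm{isthm}(N)$, and equals $\mathrm{isthm}(N)$ otherwise.
   Context: $M.X$ is contraction of $M$ to $X$ (i.e. $M/(E-X)$), $M|X$ restriction. $M(A)$, $N(B)$ matched means $M.(A\cap B)=N|(A\cap B)$. Free splice $M\mathbin{\Join} N$: matroid on $A\cup B$ with rank $r(X)=\min\{r_M(X\cap A)+|X-A|,\ r_N(X\cap B)+r_M(A-B)\}$. $\mathrm{loops}(M)$, $\mathrm{isthm}(M)$ denote the sets of loops and isthmuses (coloops) of $M$. -}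

module Defs where

open import Data.Nat using (ℕ; _+_; _∸_; _≤_; _≡ᵇ_; _<ᵇ_; _⊓_)
open import Data.Bool using (_∧_)
open import Data.Fin using (Fin)
open import Data.Fin.Subset using (Subset; _⊆_; _∩_; _∪_; _─_; _-_; ⁅_⁆; ∣_∣)
open import Data.Vec using (lookup; tabulate)
open import Relation.Binary.PropositionalEquality using (_≡_)

record Matroid (n : ℕ) : Set where
  field
    ground : Subset n
    rank   : Subset n → ℕ
    rank-≤-card : ∀ X → X ⊆ ground → rank X ≤ ∣ X ∣
    rank-mono   : ∀ X Y → Y ⊆ ground → X ⊆ Y → rank X ≤ rank Y
    rank-submod : ∀ X Y → X ⊆ ground → Y ⊆ ground →
                  rank (X ∪ Y) + rank (X ∩ Y) ≤ rank X + rank Y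
open Matroid public

loopsR : ∀ {n} → Subset n → (Subset n → ℕ) → Subset n
loopsR E r = tabulate λ e → lookup E e ∧ (r ⁅ e ⁆ ≡ᵇ 0)

isthmR : ∀ {n} → Subset n → (Subset n → ℕ) → Subset n
isthmR E r = tabulate λ e → lookup E e ∧ (r (E - e) <ᵇ r E)

loops : ∀ {n} → Matroid n → Subset n
loops M = loopsR (ground M) (rank M)

isthm : ∀ {n} → Matroid n → Subset n
isthm M = isthmR (ground M) (rank M)

-- M(A), N(B) matched: M.(A∩B) = N|(A∩B), where M.X = M/(E - X) has rank
-- Y ↦ r_M(Y ∪ (E - X)) - r_M(E - X) on subsets Y of X, and N|X has rank r_N on subsets of X.
Matched : ∀ {n} → Matroid n → Matroid n → Set
Matched M N =
  ∀ Y → Y ⊆ (ground M ∩ ground N) →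
    rank M (Y ∪ (ground M ─ (ground M ∩ ground N))) ∸ rank M (ground M ─ (ground M ∩ ground N))
      ≡ rank N Y

spliceGround : ∀ {n} → Matroid n → Matroid n → Subset n
spliceGround M N = ground M ∪ ground N

spliceRank : ∀ {n} → Matroid n → Matroid n → Subset n → ℕ
spliceRank M N X =
  (rank M (X ∩ ground M) + ∣ X ─ ground M ∣)
    ⊓ (rank N (X ∩ ground N) + rank M (ground M ─ ground N))

-- Write a = r_M(A − B) and C = A ∩ B. Matchedness says r_M(Y ∪ (A − B)) = a + r_N(Y) for
-- Y ⊆ C, and together with subadditivity of r_N this shows that on every X ⊇ A − B the second
-- term of the splice rank is the smaller one: r(X) = r_N(X ∩ B) + a. Hence deleting an element
-- of B from A ∪ B lowers the rank exactly when it lowers r_N(B), whereas deleting e ∈ A − B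
-- lowers it iff r_M(A − e) + |B − A| < r_N(B) + a. As r_N(B) ≤ r_N(C) + |B − A|, with equality
-- iff B − A consists of isthmuses of N, this happens iff e is an isthmus of M and
-- B − A ⊆ isthm(N); in that case every isthmus of M in C is one of N as well. Loops are read
-- off the singletons, r{e} = min(r_M({e} ∩ A) + |{e} − A|, r_N({e} ∩ B) + a), and a = 0 iff
-- A − B ⊆ loops(M).
module Submission where

open import Defs
open import Data.Bool using (Bool; true; false; _∧_; _∨_; not; T; if_then_else_)
open import Data.Bool.Properties using (T-≡; ¬-not; ∧-identityʳ; ∧-zeroʳ; ∨-identityʳ)
open import Data.Empty using (⊥-elim)
open import Data.Fin using (Fin; zero; suc)
open import Data.Fin.Properties using () renaming (_≟_ to _≟ᶠ_)
open import Data.Fin.Subset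
open import Data.Fin.Subset.Induction using (⊂-wellFounded)
open import Data.Fin.Subset.Properties
open import Data.Nat using (ℕ; zero; suc; s≤s; _+_; _*_; _∸_; _≤_; _<_; _⊓_; _≡ᵇ_; _<ᵇ_; _≤ᵇ_)
open import Data.Nat.Properties
open import Data.Product using (_×_; _,_; proj₁; proj₂; map₂)
open import Data.Sum using (inj₁; inj₂)
open import Data.Vec using (_∷_; here; there; lookup; tabulate)
open import Data.Vec.Properties
  using (lookup∘tabulate; tabulate∘lookup; tabulate-cong; lookup-zipWith; lookup-replicate; []=⇒lookup; lookup⇒[]=)
open import Function using (_⇔_; mk⇔; Equivalence; _∘_)
open import Function.Construct.Composition using (_⇔-∘_)
open import Function.Construct.Symmetry using (⇔-sym)
open import Induction.WellFounded using (module All)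
open import Level using (Level)
open import Relation.Nullary using (¬_; Dec; yes; no)
open import Relation.Binary.PropositionalEquality

private
  variable
    ℓ : Level
    n : ℕ
    x y : Fin n
    p q : Subset n

-- Finite subsets

x∈p─q⇒x∉q : x ∈ p ─ q → x ∉ q
x∈p─q⇒x∉q {x = zero} {p = _ ∷ _} {q = inside ∷ _} ()
x∈p─q⇒x∉q {x = zero} {p = _ ∷ _} {q = outside ∷ _} _ ()
x∈p─q⇒x∉q {x = suc _} {p = _ ∷ _} {q = _ ∷ _} (there x∈p─q) (there x∈q) = x∈p─q⇒x∉q x∈p─q x∈q

x∈p-y⇒x≢y : x ∈ p - y → x ≢ y
x∈p-y⇒x≢y x∈p-y = x∉⁅y⁆⇒x≢y (x∈p─q⇒x∉q x∈p-y)

x∈p⇒⁅x⁆⊆p : x ∈ p → ⁅ x ⁆ ⊆ p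
x∈p⇒⁅x⁆⊆p {x = x} x∈p y∈⁅x⁆ = subst (_∈ _) (sym (x∈⁅y⁆⇒x≡y x y∈⁅x⁆)) x∈p

p⊆r∧q⊆r⇒p∪q⊆r : ∀ {p q r : Subset n} → p ⊆ r → q ⊆ r → p ∪ q ⊆ r
p⊆r∧q⊆r⇒p∪q⊆r {p = p} {q = q} p⊆r q⊆r x∈p∪q with x∈p∪q⁻ p q x∈p∪q
... | inj₁ x∈p = p⊆r x∈p
... | inj₂ x∈q = q⊆r x∈q

p⊆p─q∪q : ∀ (p q : Subset n) → p ⊆ (p ─ q) ∪ q
p⊆p─q∪q p q {y} y∈p with y ∈? q
... | yes y∈q = q⊆p∪q _ q y∈q
... | no  y∉q = p⊆p∪q q (x∈p∧x∉q⇒x∈p─q y∈p y∉q)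

p-x⊆p─q∪q-x : ∀ {p q : Subset n} {x} → p - x ⊆ (p ─ q) ∪ (q - x)
p-x⊆p─q∪q-x {p = p} {q} {_} {y} y∈p-x with y ∈? q
... | yes y∈q = x∈p∪q⁺ (inj₂ (x∈p∧x∉q⇒x∈p─q y∈q (x∈p─q⇒x∉q y∈p-x)))
... | no  y∉q = x∈p∪q⁺ (inj₁ (x∈p∧x∉q⇒x∈p─q (p─q⊆p p _ y∈p-x) y∉q))

p∪q⊆p∪q-x∪⁅x⁆ : ∀ {p q : Subset n} {x} → p ∪ q ⊆ (p ∪ (q - x)) ∪ ⁅ x ⁆
p∪q⊆p∪q-x∪⁅x⁆ {p = p} {q} {x} y∈p∪q with x∈p∪q⁻ p q y∈p∪q
... | inj₁ y∈p = x∈p∪q⁺ (inj₁ (x∈p∪q⁺ (inj₁ y∈p)))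
... | inj₂ y∈q with x∈p∪q⁻ _ _ (p⊆p─q∪q q ⁅ x ⁆ y∈q)
...   | inj₁ y∈q-x = x∈p∪q⁺ (inj₁ (x∈p∪q⁺ (inj₂ y∈q-x)))
...   | inj₂ y∈⁅x⁆ = x∈p∪q⁺ (inj₂ y∈⁅x⁆)

p∪q-x∪⁅x⁆⊆p∪q : ∀ {p q : Subset n} {x} → x ∈ q → (p ∪ (q - x)) ∪ ⁅ x ⁆ ⊆ p ∪ q
p∪q-x∪⁅x⁆⊆p∪q {p = p} {q} {x} x∈q y∈ with x∈p∪q⁻ (p ∪ (q - x)) ⁅ x ⁆ y∈
... | inj₂ y∈⁅x⁆ = q⊆p∪q p q (x∈p⇒⁅x⁆⊆p x∈q y∈⁅x⁆)
... | inj₁ y∈p∪q-x with x∈p∪q⁻ p (q - x) y∈p∪q-x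
...   | inj₁ y∈p   = p⊆p∪q q y∈p
...   | inj₂ y∈q-x = q⊆p∪q p q (p─q⊆p q _ y∈q-x)

r∩q⊆r∩[p∩q]∪r─p : ∀ (p q r : Subset n) → r ∩ q ⊆ (r ∩ (p ∩ q)) ∪ (r ─ p)
r∩q⊆r∩[p∩q]∪r─p p q r {y} y∈ with x∈p∩q⁻ r q y∈ | y ∈? p
... | y∈r , y∈q | yes y∈p = p⊆p∪q _ (x∈p∩q⁺ (y∈r , x∈p∩q⁺ (y∈p , y∈q)))
... | y∈r , _   | no  y∉p = q⊆p∪q _ _ (x∈p∧x∉q⇒x∈p─q y∈r y∉p)

p⊆q⇒p∩q≡p : p ⊆ q → p ∩ q ≡ p
p⊆q⇒p∩q≡p p⊆q = ⊆-antisym (p∩q⊆p _ _) (λ y∈p → x∈p∩q⁺ (y∈p , p⊆q y∈p))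

r⊆p⇒p∪[q∪r]≡p∪q : ∀ {p q r : Subset n} → r ⊆ p → p ∪ (q ∪ r) ≡ p ∪ q
r⊆p⇒p∪[q∪r]≡p∪q {p = p} {q} {r} r⊆p = ⊆-antisym
  (p⊆r∧q⊆r⇒p∪q⊆r (p⊆p∪q q) (p⊆r∧q⊆r⇒p∪q⊆r (q⊆p∪q p q) (p⊆p∪q q ∘ r⊆p)))
  (p⊆r∧q⊆r⇒p∪q⊆r (p⊆p∪q (q ∪ r)) (q⊆p∪q p (q ∪ r) ∘ p⊆p∪q r))

p∩q∪p─q≡p : ∀ (p q : Subset n) → (p ∩ q) ∪ (p ─ q) ≡ p
p∩q∪p─q≡p p q = ⊆-antisym (p⊆r∧q⊆r⇒p∪q⊆r (p∩q⊆p p q) (p─q⊆p p q)) from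
  where
  from : p ⊆ (p ∩ q) ∪ (p ─ q)
  from {y} y∈p with y ∈? q
  ... | yes y∈q = p⊆p∪q _ (x∈p∩q⁺ (y∈p , y∈q))
  ... | no  y∉q = q⊆p∪q _ _ (x∈p∧x∉q⇒x∈p─q y∈p y∉q)

p─[p∩q]≡p─q : ∀ (p q : Subset n) → p ─ (p ∩ q) ≡ p ─ q
p─[p∩q]≡p─q p q = ⊆-antisym
  (λ y∈ → x∈p∧x∉q⇒x∈p─q (p─q⊆p p _ y∈) (λ y∈q → x∈p─q⇒x∉q y∈ (x∈p∩q⁺ (p─q⊆p p _ y∈ , y∈q))))
  (λ y∈ → x∈p∧x∉q⇒x∈p─q (p─q⊆p p _ y∈) (x∈p─q⇒x∉q y∈ ∘ p∩q⊆q p q))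

p─[p─q]≡p∩q : ∀ (p q : Subset n) → p ─ (p ─ q) ≡ p ∩ q
p─[p─q]≡p∩q p q = ⊆-antisym to from
  where
  to : p ─ (p ─ q) ⊆ p ∩ q
  to {y} y∈ with y ∈? q
  ... | yes y∈q = x∈p∩q⁺ (p─q⊆p p _ y∈ , y∈q)
  ... | no  y∉q = ⊥-elim (x∈p─q⇒x∉q y∈ (x∈p∧x∉q⇒x∈p─q (p─q⊆p p _ y∈) y∉q))
  from : p ∩ q ⊆ p ─ (p ─ q)
  from y∈ = x∈p∧x∉q⇒x∈p─q (p∩q⊆p p q y∈) (λ y∈p─q → x∈p─q⇒x∉q y∈p─q (p∩q⊆q p q y∈))

p─q⊆r⇒r∩p≡r∩[p∩q]∪p─q : ∀ {p q r : Subset n} → p ─ q ⊆ r → r ∩ p ≡ (r ∩ (p ∩ q)) ∪ (p ─ q)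
p─q⊆r⇒r∩p≡r∩[p∩q]∪p─q {p = p} {q} {r} p─q⊆r = ⊆-antisym to
  (p⊆r∧q⊆r⇒p∪q⊆r (λ y∈ → x∈p∩q⁺ (p∩q⊆p r _ y∈ , p∩q⊆p p q (p∩q⊆q r _ y∈)))
                 (λ y∈ → x∈p∩q⁺ (p─q⊆r y∈ , p─q⊆p p q y∈)))
  where
  to : r ∩ p ⊆ (r ∩ (p ∩ q)) ∪ (p ─ q)
  to {y} y∈ with x∈p∩q⁻ r p y∈ | y ∈? q
  ... | y∈r , y∈p | yes y∈q = p⊆p∪q _ (x∈p∩q⁺ (y∈r , x∈p∩q⁺ (y∈p , y∈q)))
  ... | _   , y∈p | no  y∉q = q⊆p∪q _ _ (x∈p∧x∉q⇒x∈p─q y∈p y∉q)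

q⊆p⇒[p-x]∩q≡q-x : ∀ {p q : Subset n} {x} → q ⊆ p → (p - x) ∩ q ≡ q - x
q⊆p⇒[p-x]∩q≡q-x {q = q} q⊆p = ⊆-antisym
  (λ y∈ → x∈p∧x∉q⇒x∈p─q (p∩q⊆q _ q y∈) (x∈p─q⇒x∉q (p∩q⊆p _ q y∈)))
  (λ y∈ → x∈p∩q⁺ (x∈p∧x∉q⇒x∈p─q (q⊆p (p─q⊆p q _ y∈)) (x∈p─q⇒x∉q y∈) , p─q⊆p q _ y∈))

x∈p⇒[p∪q-x]─p≡q─p : ∀ {p q : Subset n} {x} → x ∈ p → ((p ∪ q) - x) ─ p ≡ q ─ p
x∈p⇒[p∪q-x]─p≡q─p {p = p} {q} {x} x∈p = ⊆-antisym to from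
  where
  to : ((p ∪ q) - x) ─ p ⊆ q ─ p
  to {y} y∈ with x∈p∪q⁻ p q (p─q⊆p _ _ (p─q⊆p _ p y∈))
  ... | inj₁ y∈p = ⊥-elim (x∈p─q⇒x∉q y∈ y∈p)
  ... | inj₂ y∈q = x∈p∧x∉q⇒x∈p─q y∈q (x∈p─q⇒x∉q y∈)
  from : q ─ p ⊆ ((p ∪ q) - x) ─ p
  from y∈ = x∈p∧x∉q⇒x∈p─q
    (x∈p∧x≢y⇒x∈p-y (q⊆p∪q p q (p─q⊆p q p y∈)) (λ { refl → x∈p─q⇒x∉q y∈ x∈p }))
    (x∈p─q⇒x∉q y∈)

⁅x⁆∩p≡⊥ : x ∉ p → ⁅ x ⁆ ∩ p ≡ ⊥
⁅x⁆∩p≡⊥ {x = x} x∉p = ⊆-antisym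
  (λ y∈ → ⊥-elim (x∉p (subst (_∈ _) (x∈⁅y⁆⇒x≡y x (p∩q⊆p _ _ y∈)) (p∩q⊆q _ _ y∈)))) ⊥⊆

⁅x⁆─p≡⊥ : x ∈ p → ⁅ x ⁆ ─ p ≡ ⊥
⁅x⁆─p≡⊥ {x = x} x∈p = ⊆-antisym
  (λ y∈ → ⊥-elim (x∈p─q⇒x∉q y∈ (subst (_∈ _) (sym (x∈⁅y⁆⇒x≡y x (p─q⊆p _ _ y∈))) x∈p))) ⊥⊆

⁅x⁆─p≡⁅x⁆ : x ∉ p → ⁅ x ⁆ ─ p ≡ ⁅ x ⁆
⁅x⁆─p≡⁅x⁆ {x = x} x∉p = ⊆-antisym (p─q⊆p _ _)
  (λ y∈ → x∈p∧x∉q⇒x∈p─q y∈ (x∉p ∘ subst (_∈ _) (x∈⁅y⁆⇒x≡y x y∈)))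

x∈p⇒∣p∣≡1+∣p-x∣ : x ∈ p → ∣ p ∣ ≡ suc ∣ p - x ∣
x∈p⇒∣p∣≡1+∣p-x∣ {p = inside ∷ p} here = cong suc (cong ∣_∣ (sym (p─⊥≡p p)))
x∈p⇒∣p∣≡1+∣p-x∣ {p = inside ∷ _} (there x∈p) = cong suc (x∈p⇒∣p∣≡1+∣p-x∣ x∈p)
x∈p⇒∣p∣≡1+∣p-x∣ {p = outside ∷ _} (there x∈p) = x∈p⇒∣p∣≡1+∣p-x∣ x∈p

removal-induction : (P : Subset n → Set ℓ) → P ⊥ →
                    (∀ {T x} → x ∈ T → P (T - x) → P T) → ∀ T → P T
removal-induction {ℓ = ℓ} P base step = All.wfRec ⊂-wellFounded ℓ P rec
  where
  rec : ∀ T → (∀ {U} → U ⊂ T → P U) → P T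
  rec T ih with nonempty? T
  ... | no  T-empty   = subst P (sym (Empty-unique T-empty)) base
  ... | yes (x , x∈T) = step x∈T (ih (x∈p⇒p-x⊂p x∈T))

lookup-ext : ∀ {p q : Subset n} → (∀ x → lookup p x ≡ lookup q x) → p ≡ q
lookup-ext {p = p} {q} eq = trans (sym (tabulate∘lookup p)) (trans (tabulate-cong eq) (tabulate∘lookup q))

lookup-∪ : ∀ (p q : Subset n) x → lookup (p ∪ q) x ≡ lookup p x ∨ lookup q x
lookup-∪ p q x = lookup-zipWith _∨_ x p q

lookup-─ : ∀ (p q : Subset n) x → lookup (p ─ q) x ≡ lookup p x ∧ not (lookup q x)
lookup-─ (s ∷ _) (inside  ∷ _) zero    = sym (∧-zeroʳ s)
lookup-─ (s ∷ _) (outside ∷ _) zero    = sym (∧-identityʳ s)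
lookup-─ (_ ∷ p) (_       ∷ q) (suc x) = lookup-─ p q x

lookup-if : ∀ b (p : Subset n) x → lookup (if b then p else ⊥) x ≡ lookup p x ∧ b
lookup-if true  p x = sym (∧-identityʳ _)
lookup-if false p x = trans (lookup-replicate x false) (sym (∧-zeroʳ _))

lookup-∉ : x ∉ p → lookup p x ≡ false
lookup-∉ {x = x} {p} x∉p = ¬-not (x∉p ∘ lookup⇒[]= x p)

∧-∨-absorb : ∀ b k c → (b ≡ true → k ≡ true → c ≡ true) → (b ∧ k) ∨ c ≡ c
∧-∨-absorb false k     c _ = refl
∧-∨-absorb true  false c _ = refl
∧-∨-absorb true  true  c h = sym (h refl refl)

-- Boolean tests on natural numbers

m⊓n≡ᵇ0 : ∀ m n → (m ⊓ n ≡ᵇ 0) ≡ (m ≡ᵇ 0) ∨ (n ≡ᵇ 0)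
m⊓n≡ᵇ0 zero    n       = refl
m⊓n≡ᵇ0 (suc m) zero    = refl
m⊓n≡ᵇ0 (suc m) (suc n) = refl

m+n≡ᵇ0 : ∀ m n → (m + n ≡ᵇ 0) ≡ (m ≡ᵇ 0) ∧ (n ≡ᵇ 0)
m+n≡ᵇ0 zero    n = refl
m+n≡ᵇ0 (suc m) n = refl

m⊓n<ᵇn≡m<ᵇn : ∀ m n → (m ⊓ n <ᵇ n) ≡ (m <ᵇ n)
m⊓n<ᵇn≡m<ᵇn zero    n       = refl
m⊓n<ᵇn≡m<ᵇn (suc m) zero    = refl
m⊓n<ᵇn≡m<ᵇn (suc m) (suc n) = m⊓n<ᵇn≡m<ᵇn m n

m+o<ᵇn+o≡m<ᵇn : ∀ m n o → (m + o <ᵇ n + o) ≡ (m <ᵇ n)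
m+o<ᵇn+o≡m<ᵇn m n o = trans (cong₂ _<ᵇ_ (+-comm m o) (+-comm n o)) (o+m<ᵇo+n o)
  where
  o+m<ᵇo+n : ∀ o → (o + m <ᵇ o + n) ≡ (m <ᵇ n)
  o+m<ᵇo+n zero    = refl
  o+m<ᵇo+n (suc o) = o+m<ᵇo+n o

≡ᵇ-reflects : ∀ {m n} → (m ≡ᵇ n) ≡ true ⇔ m ≡ n
≡ᵇ-reflects = mk⇔ (≡ᵇ⇒≡ _ _ ∘ Equivalence.from T-≡) (Equivalence.to T-≡ ∘ ≡⇒≡ᵇ _ _)

<ᵇ-reflects : ∀ {m n} → (m <ᵇ n) ≡ true ⇔ m < n
<ᵇ-reflects = mk⇔ (<ᵇ⇒< _ _ ∘ Equivalence.from T-≡) (Equivalence.to T-≡ ∘ <⇒<ᵇ)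

≤ᵇ-reflects : ∀ {m n} → (m ≤ᵇ n) ≡ true ⇔ m ≤ n
≤ᵇ-reflects = mk⇔ (≤ᵇ⇒≤ _ _ ∘ Equivalence.from T-≡) (Equivalence.to T-≡ ∘ ≤⇒≤ᵇ)

-- Loops and isthmuses of a rank function

lookup-loopsR : ∀ (p : Subset n) r x → lookup (loopsR p r) x ≡ lookup p x ∧ (r ⁅ x ⁆ ≡ᵇ 0)
lookup-loopsR p r = lookup∘tabulate _

lookup-isthmR : ∀ (p : Subset n) r x → lookup (isthmR p r) x ≡ lookup p x ∧ (r (p - x) <ᵇ r p)
lookup-isthmR p r = lookup∘tabulate _

∈-separation : ∀ (p : Subset n) (b : Fin n → Bool) →
               x ∈ tabulate (λ e → lookup p e ∧ b e) ⇔ (x ∈ p × T (b x))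
∈-separation {x = x} p b = mk⇔ to from
  where
  to : x ∈ tabulate (λ e → lookup p e ∧ b e) → x ∈ p × T (b x)
  to x∈ with lookup p x in eq | b x | trans (sym (lookup∘tabulate _ x)) ([]=⇒lookup x∈)
  ... | true | true | _ = lookup⇒[]= x p eq , _
  from : x ∈ p × T (b x) → x ∈ tabulate (λ e → lookup p e ∧ b e)
  from (x∈p , bx) =
    lookup⇒[]= x _ (trans (lookup∘tabulate _ x) (cong₂ _∧_ ([]=⇒lookup x∈p) (Equivalence.to T-≡ bx)))

∈loopsR⇔ : ∀ (p : Subset n) r → x ∈ loopsR p r ⇔ (x ∈ p × r ⁅ x ⁆ ≡ 0)
∈loopsR⇔ p r = mk⇔ (map₂ (≡ᵇ⇒≡ _ 0) ∘ to) (from ∘ map₂ (≡⇒≡ᵇ _ 0))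
  where open Equivalence (∈-separation p (λ e → r ⁅ e ⁆ ≡ᵇ 0))

∈isthmR⇔ : ∀ (p : Subset n) r → x ∈ isthmR p r ⇔ (x ∈ p × r (p - x) < r p)
∈isthmR⇔ p r = mk⇔ (map₂ (<ᵇ⇒< _ _) ∘ to) (from ∘ map₂ <⇒<ᵇ)
  where open Equivalence (∈-separation p (λ e → r (p - e) <ᵇ r p))

module MatroidRank (M : Matroid n) where
  private
    r : Subset n → ℕ
    r = rank M
    E : Subset n
    E = ground M

  -- The rank functions of M extended to all of Fin n by making every element outside E an
  -- isthmus, resp. a loop; the free splice rank is the minimum of rank⁺ for M and rank⁰ for N
  -- shifted by r_M(A − B).
  rank⁺ rank⁰ : Subset n → ℕ
  rank⁺ X = r (X ∩ E) + ∣ X ─ E ∣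
  rank⁰ X = r (X ∩ E)

  ∈loops⇔ : x ∈ loops M ⇔ (x ∈ E × r ⁅ x ⁆ ≡ 0)
  ∈loops⇔ = ∈loopsR⇔ E r

  ∈isthm⇔ : x ∈ isthm M ⇔ (x ∈ E × r (E - x) < r E)
  ∈isthm⇔ = ∈isthmR⇔ E r

  rank-⊥ : r ⊥ ≡ 0
  rank-⊥ = n≤0⇒n≡0 (≤-trans (rank-≤-card M ⊥ ⊥⊆) (≤-reflexive (∣⊥∣≡0 n)))

  rank-⁅⁆≤1 : x ∈ E → r ⁅ x ⁆ ≤ 1
  rank-⁅⁆≤1 {x = x} x∈E =
    ≤-trans (rank-≤-card M ⁅ x ⁆ (x∈p⇒⁅x⁆⊆p x∈E)) (≤-reflexive (∣⁅x⁆∣≡1 x))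

  rank-∪⁅⁆≤ : ∀ {Y} → Y ⊆ E → x ∈ E → r (Y ∪ ⁅ x ⁆) ≤ r Y + r ⁅ x ⁆
  rank-∪⁅⁆≤ {x = x} {Y} Y⊆E x∈E = ≤-trans (m≤m+n _ _) (rank-submod M Y ⁅ x ⁆ Y⊆E (x∈p⇒⁅x⁆⊆p x∈E))

  rank-∪≤rank+k*∣T∣ : ∀ k {Y} T → (∀ {t} → t ∈ T → r ⁅ t ⁆ ≤ k) →
                      Y ⊆ E → T ⊆ E → r (Y ∪ T) ≤ r Y + k * ∣ T ∣
  rank-∪≤rank+k*∣T∣ k {Y} = removal-induction P base step
    where
    P : Subset n → Set
    P T = (∀ {t} → t ∈ T → r ⁅ t ⁆ ≤ k) → Y ⊆ E → T ⊆ E → r (Y ∪ T) ≤ r Y + k * ∣ T ∣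
    base : P ⊥
    base _ _ _ = begin
      r (Y ∪ ⊥)        ≡⟨ cong r (∪-identityʳ Y) ⟩
      r Y              ≤⟨ m≤m+n _ _ ⟩
      r Y + k * ∣ ⊥ {n} ∣  ∎
      where open ≤-Reasoning
    step : ∀ {T x} → x ∈ T → P (T - x) → P T
    step {T} {x} x∈T ih bounded Y⊆E T⊆E = begin
      r (Y ∪ T)                ≤⟨ rank-mono M _ _ Z∪x⊆E p∪q⊆p∪q-x∪⁅x⁆ ⟩
      r (Z ∪ ⁅ x ⁆)            ≤⟨ rank-∪⁅⁆≤ Z⊆E x∈E ⟩
      r Z + r ⁅ x ⁆            ≤⟨ +-mono-≤ (ih (bounded ∘ p─q⊆p _ _) Y⊆E T-x⊆E) (bounded x∈T) ⟩
      r Y + k * ∣ T - x ∣ + k  ≡⟨ +-assoc (r Y) _ k ⟩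
      r Y + (k * ∣ T - x ∣ + k) ≡⟨ cong (r Y +_) (+-comm _ k) ⟩
      r Y + (k + k * ∣ T - x ∣) ≡⟨ cong (r Y +_) (sym (*-suc k _)) ⟩
      r Y + k * suc ∣ T - x ∣  ≡⟨ cong (λ c → r Y + k * c) (sym (x∈p⇒∣p∣≡1+∣p-x∣ x∈T)) ⟩
      r Y + k * ∣ T ∣          ∎
      where
      open ≤-Reasoning
      Z : Subset n
      Z = Y ∪ (T - x)
      x∈E : x ∈ E
      x∈E = T⊆E x∈T
      T-x⊆E : T - x ⊆ E
      T-x⊆E = T⊆E ∘ p─q⊆p _ _
      Z⊆E : Z ⊆ E
      Z⊆E = p⊆r∧q⊆r⇒p∪q⊆r Y⊆E T-x⊆E
      Z∪x⊆E : Z ∪ ⁅ x ⁆ ⊆ E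
      Z∪x⊆E = p⊆r∧q⊆r⇒p∪q⊆r Z⊆E (x∈p⇒⁅x⁆⊆p x∈E)

  rank-∪≤rank+∣T∣ : ∀ {Y T} → Y ⊆ E → T ⊆ E → r (Y ∪ T) ≤ r Y + ∣ T ∣
  rank-∪≤rank+∣T∣ {Y} {T} Y⊆E T⊆E = subst (λ c → r (Y ∪ T) ≤ r Y + c) (*-identityˡ ∣ T ∣)
    (rank-∪≤rank+k*∣T∣ 1 T (rank-⁅⁆≤1 ∘ T⊆E) Y⊆E T⊆E)

  ⊆loops⇔rank≡0 : ∀ {T} → T ⊆ E → T ⊆ loops M ⇔ r T ≡ 0
  ⊆loops⇔rank≡0 {T} T⊆E = mk⇔ rank≡0 (λ rT≡0 t∈T → from ∈loops⇔ (T⊆E t∈T , rank-⁅t⁆≡0 rT≡0 t∈T))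
    where
    open Equivalence
    rank≡0 : T ⊆ loops M → r T ≡ 0
    rank≡0 T⊆loops = n≤0⇒n≡0 (begin
      r T              ≡⟨ cong r (sym (∪-identityˡ T)) ⟩
      r (⊥ ∪ T)        ≤⟨ rank-∪≤rank+k*∣T∣ 0 T (≤-reflexive ∘ proj₂ ∘ to ∈loops⇔ ∘ T⊆loops) ⊥⊆ T⊆E ⟩
      r ⊥ + 0          ≡⟨ +-identityʳ _ ⟩
      r ⊥              ≡⟨ rank-⊥ ⟩
      0                ∎)
      where open ≤-Reasoning
    rank-⁅t⁆≡0 : r T ≡ 0 → ∀ {t} → t ∈ T → r ⁅ t ⁆ ≡ 0
    rank-⁅t⁆≡0 rT≡0 t∈T = n≤0⇒n≡0 (≤-trans (rank-mono M _ T T⊆E (x∈p⇒⁅x⁆⊆p t∈T)) (≤-reflexive rT≡0))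

  isthm⊆ground : isthm M ⊆ E
  isthm⊆ground = proj₁ ∘ Equivalence.to ∈isthm⇔

  isthm-raises-rank : x ∈ isthm M → ∀ {Z} → Z ⊆ E - x → r Z < r (Z ∪ ⁅ x ⁆)
  isthm-raises-rank {x = x} x∈isthm {Z} Z⊆E-x = +-cancelˡ-≤ (r P) _ _ (begin
    r P + suc (r Z)   ≡⟨ +-suc (r P) (r Z) ⟩
    suc (r P) + r Z   ≤⟨ +-monoˡ-≤ (r Z) rP<rE ⟩
    r E + r Z         ≤⟨ +-mono-≤ (rank-mono M E (P ∪ Q) P∪Q⊆E E⊆P∪Q) (rank-mono M Z (P ∩ Q) P∩Q⊆E Z⊆P∩Q) ⟩
    r (P ∪ Q) + r (P ∩ Q) ≤⟨ rank-submod M P Q P⊆E Q⊆E ⟩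
    r P + r Q         ∎)
    where
    open ≤-Reasoning
    P Q : Subset n
    P = E - x
    Q = Z ∪ ⁅ x ⁆
    x∈E : x ∈ E
    x∈E = isthm⊆ground x∈isthm
    rP<rE : r P < r E
    rP<rE = proj₂ (Equivalence.to ∈isthm⇔ x∈isthm)
    P⊆E : P ⊆ E
    P⊆E = p─q⊆p _ _
    Q⊆E : Q ⊆ E
    Q⊆E = p⊆r∧q⊆r⇒p∪q⊆r (P⊆E ∘ Z⊆E-x) (x∈p⇒⁅x⁆⊆p x∈E)
    P∪Q⊆E : P ∪ Q ⊆ E
    P∪Q⊆E = p⊆r∧q⊆r⇒p∪q⊆r P⊆E Q⊆E
    P∩Q⊆E : P ∩ Q ⊆ E
    P∩Q⊆E = P⊆E ∘ p∩q⊆p _ _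
    E⊆P∪Q : E ⊆ P ∪ Q
    E⊆P∪Q y∈E with x∈p∪q⁻ P ⁅ x ⁆ (p⊆p─q∪q E ⁅ x ⁆ y∈E)
    ... | inj₁ y∈P = x∈p∪q⁺ (inj₁ y∈P)
    ... | inj₂ y∈⁅x⁆ = x∈p∪q⁺ (inj₂ (q⊆p∪q Z _ y∈⁅x⁆))
    Z⊆P∩Q : Z ⊆ P ∩ Q
    Z⊆P∩Q y∈Z = x∈p∩q⁺ (Z⊆E-x y∈Z , p⊆p∪q _ y∈Z)

  isthms-raise-rank : ∀ T → T ⊆ isthm M → ∀ {Y} → Y ⊆ E ─ T → r Y + ∣ T ∣ ≤ r (Y ∪ T)
  isthms-raise-rank = removal-induction P base step
    where
    P : Subset n → Set
    P T = T ⊆ isthm M → ∀ {Y} → Y ⊆ E ─ T → r Y + ∣ T ∣ ≤ r (Y ∪ T)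
    base : P ⊥
    base _ {Y} _ = ≤-reflexive (begin
      r Y + ∣ ⊥ {n} ∣  ≡⟨ cong (r Y +_) (∣⊥∣≡0 n) ⟩
      r Y + 0          ≡⟨ +-identityʳ (r Y) ⟩
      r Y              ≡⟨ cong r (∪-identityʳ Y) ⟨
      r (Y ∪ ⊥)        ∎)
      where open ≡-Reasoning
    step : ∀ {T x} → x ∈ T → P (T - x) → P T
    step {T} {x} x∈T ih T⊆isthm {Y} Y⊆E─T = begin
      r Y + ∣ T ∣               ≡⟨ cong (r Y +_) (x∈p⇒∣p∣≡1+∣p-x∣ x∈T) ⟩
      r Y + suc ∣ T - x ∣       ≡⟨ +-suc (r Y) _ ⟩
      suc (r Y + ∣ T - x ∣)     ≤⟨ s≤s (ih (T⊆isthm ∘ p─q⊆p _ _) Y⊆E─[T-x]) ⟩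
      suc (r Z)                 ≤⟨ isthm-raises-rank (T⊆isthm x∈T) Z⊆E-x ⟩
      r (Z ∪ ⁅ x ⁆)             ≤⟨ rank-mono M _ _ Y∪T⊆E (p∪q-x∪⁅x⁆⊆p∪q x∈T) ⟩
      r (Y ∪ T)                 ∎
      where
      open ≤-Reasoning
      Z : Subset n
      Z = Y ∪ (T - x)
      T⊆E : T ⊆ E
      T⊆E = isthm⊆ground ∘ T⊆isthm
      Y⊆E : Y ⊆ E
      Y⊆E = p─q⊆p _ _ ∘ Y⊆E─T
      Y∪T⊆E : Y ∪ T ⊆ E
      Y∪T⊆E = p⊆r∧q⊆r⇒p∪q⊆r Y⊆E T⊆E
      Y⊆E─[T-x] : Y ⊆ E ─ (T - x)
      Y⊆E─[T-x] y∈Y = x∈p∧x∉q⇒x∈p─q (Y⊆E y∈Y) (x∈p─q⇒x∉q (Y⊆E─T y∈Y) ∘ p─q⊆p _ _)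
      Z⊆E-x : Z ⊆ E - x
      Z⊆E-x = p⊆r∧q⊆r⇒p∪q⊆r
        (λ y∈Y → x∈p∧x≢y⇒x∈p-y (Y⊆E y∈Y) (λ { refl → x∈p─q⇒x∉q (Y⊆E─T y∈Y) x∈T }))
        (λ y∈T-x → x∈p∧x≢y⇒x∈p-y (T⊆E (p─q⊆p _ _ y∈T-x)) (x∈p-y⇒x≢y y∈T-x))

  ⊆isthm⇔ : ∀ {T} → T ⊆ E → T ⊆ isthm M ⇔ r (E ─ T) + ∣ T ∣ ≤ r E
  ⊆isthm⇔ {T} T⊆E = mk⇔ bound isthmus
    where
    bound : T ⊆ isthm M → r (E ─ T) + ∣ T ∣ ≤ r E
    bound T⊆isthm = ≤-trans (isthms-raise-rank T T⊆isthm ⊆-refl)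
                            (rank-mono M _ E ⊆-refl (p⊆r∧q⊆r⇒p∪q⊆r (p─q⊆p E T) T⊆E))
    isthmus : r (E ─ T) + ∣ T ∣ ≤ r E → T ⊆ isthm M
    isthmus tight {t} t∈T = Equivalence.from ∈isthm⇔ (T⊆E t∈T , (begin-strict
      r (E - t)                 ≤⟨ rank-mono M _ _ (p⊆r∧q⊆r⇒p∪q⊆r (p─q⊆p E T) T-t⊆E) p-x⊆p─q∪q-x ⟩
      r ((E ─ T) ∪ (T - t))     ≤⟨ rank-∪≤rank+∣T∣ (p─q⊆p E T) T-t⊆E ⟩
      r (E ─ T) + ∣ T - t ∣     <⟨ +-monoʳ-< (r (E ─ T)) (x∈p⇒∣p-x∣<∣p∣ t∈T) ⟩
      r (E ─ T) + ∣ T ∣         ≤⟨ tight ⟩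
      r E                       ∎))
      where
      open ≤-Reasoning
      T-t⊆E : T - t ⊆ E
      T-t⊆E = T⊆E ∘ p─q⊆p T _

  rank≤rank[E─T]+∣T∣ : ∀ {T} → T ⊆ E → r E ≤ r (E ─ T) + ∣ T ∣
  rank≤rank[E─T]+∣T∣ {T} T⊆E = ≤-trans
    (rank-mono M E _ (p⊆r∧q⊆r⇒p∪q⊆r (p─q⊆p E T) T⊆E) (p⊆p─q∪q E T))
    (rank-∪≤rank+∣T∣ (p─q⊆p E T) T⊆E)

  rank≤1+rank[E-x] : x ∈ E → r E ≤ 1 + r (E - x)
  rank≤1+rank[E-x] {x = x} x∈E = ≤-trans (rank≤rank[E─T]+∣T∣ (x∈p⇒⁅x⁆⊆p x∈E))
    (≤-reflexive (trans (cong (r (E - x) +_) (∣⁅x⁆∣≡1 x)) (+-comm _ 1)))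

  rank-⁅x⁆∩E : x ∈ E → r (⁅ x ⁆ ∩ E) ≡ r ⁅ x ⁆
  rank-⁅x⁆∩E x∈E = cong r (p⊆q⇒p∩q≡p (x∈p⇒⁅x⁆⊆p x∈E))

  rank-⁅x⁆∩E-∉ : x ∉ E → r (⁅ x ⁆ ∩ E) ≡ 0
  rank-⁅x⁆∩E-∉ x∉E = trans (cong r (⁅x⁆∩p≡⊥ x∉E)) rank-⊥

  rank⁺-⁅x⁆≡ᵇ0 : ∀ x → (rank⁺ ⁅ x ⁆ ≡ᵇ 0) ≡ lookup E x ∧ (r ⁅ x ⁆ ≡ᵇ 0)
  rank⁺-⁅x⁆≡ᵇ0 x with x ∈? E
  ... | yes x∈E = begin
    (r (⁅ x ⁆ ∩ E) + ∣ ⁅ x ⁆ ─ E ∣ ≡ᵇ 0)  ≡⟨ cong₂ (λ u c → u + c ≡ᵇ 0) (rank-⁅x⁆∩E x∈E) ∣⁅x⁆─E∣≡0 ⟩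
    (r ⁅ x ⁆ + 0 ≡ᵇ 0)                    ≡⟨ cong (_≡ᵇ 0) (+-identityʳ (r ⁅ x ⁆)) ⟩
    (r ⁅ x ⁆ ≡ᵇ 0)                        ≡⟨ cong (_∧ (r ⁅ x ⁆ ≡ᵇ 0)) ([]=⇒lookup x∈E) ⟨
    lookup E x ∧ (r ⁅ x ⁆ ≡ᵇ 0)           ∎
    where
    open ≡-Reasoning
    ∣⁅x⁆─E∣≡0 : ∣ ⁅ x ⁆ ─ E ∣ ≡ 0
    ∣⁅x⁆─E∣≡0 = trans (cong ∣_∣ (⁅x⁆─p≡⊥ x∈E)) (∣⊥∣≡0 n)
  ... | no x∉E = begin
    (r (⁅ x ⁆ ∩ E) + ∣ ⁅ x ⁆ ─ E ∣ ≡ᵇ 0)  ≡⟨ cong₂ (λ u c → u + c ≡ᵇ 0) (rank-⁅x⁆∩E-∉ x∉E) ∣⁅x⁆─E∣≡1 ⟩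
    false                                 ≡⟨ cong (_∧ (r ⁅ x ⁆ ≡ᵇ 0)) (lookup-∉ x∉E) ⟨
    lookup E x ∧ (r ⁅ x ⁆ ≡ᵇ 0)           ∎
    where
    open ≡-Reasoning
    ∣⁅x⁆─E∣≡1 : ∣ ⁅ x ⁆ ─ E ∣ ≡ 1
    ∣⁅x⁆─E∣≡1 = trans (cong ∣_∣ (⁅x⁆─p≡⁅x⁆ x∉E)) (∣⁅x⁆∣≡1 x)

  rank⁰-⁅x⁆≡ᵇ0 : ∀ x → (rank⁰ ⁅ x ⁆ ≡ᵇ 0) ≡ (lookup E x ∧ (r ⁅ x ⁆ ≡ᵇ 0)) ∨ not (lookup E x)
  rank⁰-⁅x⁆≡ᵇ0 x with x ∈? E
  ... | yes x∈E rewrite []=⇒lookup x∈E = trans (cong (_≡ᵇ 0) (rank-⁅x⁆∩E x∈E)) (sym (∨-identityʳ _))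
  ... | no  x∉E rewrite lookup-∉ x∉E   = cong (_≡ᵇ 0) (rank-⁅x⁆∩E-∉ x∉E)

module FreeSplice (M N : Matroid n) (matched : Matched M N) where
  private
    A B C D F S : Subset n
    A = ground M
    B = ground N
    C = A ∩ B
    D = A ─ B
    F = B ─ A
    S = spliceGround M N
    rM rN rS : Subset n → ℕ
    rM = rank M
    rN = rank N
    rS = spliceRank M N
    a : ℕ
    a = rM D
    module RM = MatroidRank M
    module RN = MatroidRank N

  rank-∪D : ∀ {Y} → Y ⊆ C → rM (Y ∪ D) ≡ a + rN Y
  rank-∪D {Y} Y⊆C = begin
    rM (Y ∪ D)            ≡⟨ m+[n∸m]≡n a≤rM[Y∪D] ⟨
    a + (rM (Y ∪ D) ∸ a)  ≡⟨ cong (a +_) contracted ⟩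
    a + rN Y              ∎
    where
    open ≡-Reasoning
    contracted : rM (Y ∪ D) ∸ a ≡ rN Y
    contracted = subst (λ Z → rM (Y ∪ Z) ∸ rM Z ≡ rN Y) (p─[p∩q]≡p─q A B) (matched Y Y⊆C)
    a≤rM[Y∪D] : a ≤ rM (Y ∪ D)
    a≤rM[Y∪D] = rank-mono M D (Y ∪ D) (p⊆r∧q⊆r⇒p∪q⊆r (p∩q⊆p A B ∘ Y⊆C) (p─q⊆p A B)) (q⊆p∪q Y D)

  rank-A : rM A ≡ a + rN C
  rank-A = trans (cong rM (sym (p∩q∪p─q≡p A B))) (rank-∪D ⊆-refl)

  spliceRank-⊇D : ∀ {X} → D ⊆ X → X ⊆ S → rS X ≡ rN (X ∩ B) + a
  spliceRank-⊇D {X} D⊆X X⊆S = m≥n⇒m⊓n≡n (begin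
    rN (X ∩ B) + a               ≤⟨ +-monoˡ-≤ a rN[X∩B]≤ ⟩
    rN (X ∩ C) + ∣ X ─ A ∣ + a    ≡⟨ +-comm _ a ⟩
    a + (rN (X ∩ C) + ∣ X ─ A ∣)  ≡⟨ +-assoc a _ _ ⟨
    a + rN (X ∩ C) + ∣ X ─ A ∣    ≡⟨ cong (_+ ∣ X ─ A ∣) rM[X∩A] ⟨
    rM (X ∩ A) + ∣ X ─ A ∣        ∎)
    where
    open ≤-Reasoning
    rM[X∩A] : rM (X ∩ A) ≡ a + rN (X ∩ C)
    rM[X∩A] = trans (cong rM (p─q⊆r⇒r∩p≡r∩[p∩q]∪p─q D⊆X)) (rank-∪D (p∩q⊆q X C))
    X∩C⊆B : X ∩ C ⊆ B
    X∩C⊆B = p∩q⊆q A B ∘ p∩q⊆q X C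
    X─A⊆B : X ─ A ⊆ B
    X─A⊆B y∈ with x∈p∪q⁻ A B (X⊆S (p─q⊆p X A y∈))
    ... | inj₁ y∈A = ⊥-elim (x∈p─q⇒x∉q y∈ y∈A)
    ... | inj₂ y∈B = y∈B
    rN[X∩B]≤ : rN (X ∩ B) ≤ rN (X ∩ C) + ∣ X ─ A ∣
    rN[X∩B]≤ = ≤-trans (rank-mono N _ _ (p⊆r∧q⊆r⇒p∪q⊆r X∩C⊆B X─A⊆B) (r∩q⊆r∩[p∩q]∪r─p A B X))
                       (RN.rank-∪≤rank+∣T∣ X∩C⊆B X─A⊆B)

  spliceRank-S : rS S ≡ rN B + a
  spliceRank-S = trans (spliceRank-⊇D (p⊆p∪q B ∘ p─q⊆p A B) ⊆-refl)
                       (cong (λ Z → rN Z + a) (trans (∩-comm S B) (p⊆q⇒p∩q≡p (q⊆p∪q A B))))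

  spliceRank-S-e : ∀ {e} → e ∈ B → rS (S - e) ≡ rN (B - e) + a
  spliceRank-S-e {e} e∈B = trans (spliceRank-⊇D D⊆S-e (p─q⊆p S _))
                                 (cong (λ Z → rN Z + a) (q⊆p⇒[p-x]∩q≡q-x (q⊆p∪q A B)))
    where
    D⊆S-e : D ⊆ S - e
    D⊆S-e y∈D = x∈p∧x≢y⇒x∈p-y (p⊆p∪q B (p─q⊆p A B y∈D)) (λ { refl → x∈p─q⇒x∉q y∈D e∈B })

  rank⁺-S-e : ∀ {e} → e ∈ A → RM.rank⁺ (S - e) ≡ rM (A - e) + ∣ F ∣
  rank⁺-S-e e∈A = cong₂ (λ X Y → rM X + ∣ Y ∣) (q⊆p⇒[p-x]∩q≡q-x (p⊆p∪q B)) (x∈p⇒[p∪q-x]─p≡q─p e∈A)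

  spliceRank-S-e≤ : ∀ {e} → e ∈ A → rS (S - e) ≤ rM (A - e) + ∣ F ∣
  spliceRank-S-e≤ e∈A = ≤-trans (m⊓n≤m _ _) (≤-reflexive (rank⁺-S-e e∈A))

  spliceRank-S-e-∉B : ∀ {e} → e ∈ A → e ∉ B → rS (S - e) ≡ (rM (A - e) + ∣ F ∣) ⊓ (rN B + a)
  spliceRank-S-e-∉B {e} e∈A e∉B =
    cong₂ _⊓_ (rank⁺-S-e e∈A) (cong (λ Z → rN Z + a) (trans (∩-comm _ B) (p⊆q⇒p∩q≡p B⊆S-e)))
    where
    B⊆S-e : B ⊆ S - e
    B⊆S-e y∈B = x∈p∧x≢y⇒x∈p-y (q⊆p∪q A B y∈B) (λ { refl → e∉B y∈B })

  B─F≡C : B ─ F ≡ C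
  B─F≡C = trans (p─[p─q]≡p∩q B A) (∩-comm B A)

  rank-B≤rank-C+∣F∣ : rN B ≤ rN C + ∣ F ∣
  rank-B≤rank-C+∣F∣ = subst (λ Z → rN B ≤ rN Z + ∣ F ∣) B─F≡C (RN.rank≤rank[E─T]+∣T∣ (p─q⊆p B A))

  F⊆isthm⇔ : F ⊆ isthm N ⇔ rN C + ∣ F ∣ ≤ rN B
  F⊆isthm⇔ = subst (λ Z → F ⊆ isthm N ⇔ rN Z + ∣ F ∣ ≤ rN B) B─F≡C (RN.⊆isthm⇔ (p─q⊆p B A))

  F⊆isthmᵇ : Bool
  F⊆isthmᵇ = rN C + ∣ F ∣ ≤ᵇ rN B

  F⊆isthmᵇ-reflects : F⊆isthmᵇ ≡ true ⇔ F ⊆ isthm N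
  F⊆isthmᵇ-reflects = ⇔-sym F⊆isthm⇔ ⇔-∘ ≤ᵇ-reflects

  rank-A+∣F∣ : rM A + ∣ F ∣ ≡ rN C + ∣ F ∣ + a
  rank-A+∣F∣ = begin
    rM A + ∣ F ∣             ≡⟨ cong (_+ ∣ F ∣) rank-A ⟩
    a + rN C + ∣ F ∣         ≡⟨ +-assoc a _ _ ⟩
    a + (rN C + ∣ F ∣)       ≡⟨ +-comm a _ ⟩
    rN C + ∣ F ∣ + a         ∎
    where open ≡-Reasoning

  rank-B+a≡rank-A+∣F∣ : rN C + ∣ F ∣ ≤ rN B → rN B + a ≡ rM A + ∣ F ∣
  rank-B+a≡rank-A+∣F∣ ≤rN[B] = trans (cong (_+ a) (≤-antisym rank-B≤rank-C+∣F∣ ≤rN[B])) (sym rank-A+∣F∣)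

  rank-B+a<rank-A+∣F∣ : ¬ rN C + ∣ F ∣ ≤ rN B → rN B + a < rM A + ∣ F ∣
  rank-B+a<rank-A+∣F∣ ≰rN[B] = subst (rN B + a <_) (sym rank-A+∣F∣) (+-monoˡ-< a (≰⇒> ≰rN[B]))

  splice-isthm-bit-∈B : ∀ {e} → e ∈ B → (rS (S - e) <ᵇ rS S) ≡ (rN (B - e) <ᵇ rN B)
  splice-isthm-bit-∈B {e} e∈B =
    trans (cong₂ _<ᵇ_ (spliceRank-S-e e∈B) spliceRank-S) (m+o<ᵇn+o≡m<ᵇn (rN (B - e)) (rN B) a)

  splice-isthm-bit-∈D : ∀ {e} → e ∈ A → e ∉ B → (rS (S - e) <ᵇ rS S) ≡ (rM (A - e) <ᵇ rM A) ∧ F⊆isthmᵇ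
  splice-isthm-bit-∈D {e} e∈A e∉B =
    trans (cong₂ _<ᵇ_ (spliceRank-S-e-∉B e∈A e∉B) spliceRank-S)
          (trans (m⊓n<ᵇn≡m<ᵇn (rM (A - e) + ∣ F ∣) (rN B + a)) split-on-F⊆isthm)
    where
    split-on-F⊆isthm : (rM (A - e) + ∣ F ∣ <ᵇ rN B + a) ≡ (rM (A - e) <ᵇ rM A) ∧ F⊆isthmᵇ
    split-on-F⊆isthm with rN C + ∣ F ∣ ≤? rN B
    ... | yes ≤rN[B] rewrite Equivalence.from ≤ᵇ-reflects ≤rN[B] = begin
      (rM (A - e) + ∣ F ∣ <ᵇ rN B + a)     ≡⟨ cong (rM (A - e) + ∣ F ∣ <ᵇ_) (rank-B+a≡rank-A+∣F∣ ≤rN[B]) ⟩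
      (rM (A - e) + ∣ F ∣ <ᵇ rM A + ∣ F ∣)  ≡⟨ m+o<ᵇn+o≡m<ᵇn (rM (A - e)) (rM A) ∣ F ∣ ⟩
      (rM (A - e) <ᵇ rM A)                 ≡⟨ ∧-identityʳ (rM (A - e) <ᵇ rM A) ⟨
      (rM (A - e) <ᵇ rM A) ∧ true          ∎
      where open ≡-Reasoning
    ... | no ≰rN[B] rewrite ¬-not (≰rN[B] ∘ Equivalence.to ≤ᵇ-reflects) =
      trans (¬-not (≤⇒≯ rN[B]+a≤ ∘ Equivalence.to <ᵇ-reflects)) (sym (∧-zeroʳ (rM (A - e) <ᵇ rM A)))
      where
      rN[B]+a≤ : rN B + a ≤ rM (A - e) + ∣ F ∣
      rN[B]+a≤ = ≤-pred (≤-trans (rank-B+a<rank-A+∣F∣ ≰rN[B]) (+-monoˡ-≤ ∣ F ∣ (RM.rank≤1+rank[E-x] e∈A)))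

  isthmM⇒isthmN : ∀ {e} → rN C + ∣ F ∣ ≤ rN B → e ∈ A → e ∈ B →
                  rM (A - e) < rM A → rN (B - e) < rN B
  isthmM⇒isthmN {e} ≤rN[B] e∈A e∈B rM[A-e]<rM[A] = +-cancelʳ-< a _ _ (begin-strict
    rN (B - e) + a      ≡⟨ spliceRank-S-e e∈B ⟨
    rS (S - e)          ≤⟨ spliceRank-S-e≤ e∈A ⟩
    rM (A - e) + ∣ F ∣  <⟨ +-monoˡ-< ∣ F ∣ rM[A-e]<rM[A] ⟩
    rM A + ∣ F ∣        ≡⟨ rank-B+a≡rank-A+∣F∣ ≤rN[B] ⟨
    rN B + a            ∎)
    where open ≤-Reasoning

  D⊆loopsᵇ : Bool
  D⊆loopsᵇ = a ≡ᵇ 0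

  D⊆loopsᵇ-reflects : D⊆loopsᵇ ≡ true ⇔ D ⊆ loops M
  D⊆loopsᵇ-reflects = ⇔-sym (RM.⊆loops⇔rank≡0 (p─q⊆p A B)) ⇔-∘ ≡ᵇ-reflects

  splice-loop-bit : ∀ e → (rS ⁅ e ⁆ ≡ᵇ 0) ≡
    (lookup A e ∧ (rM ⁅ e ⁆ ≡ᵇ 0)) ∨ (((lookup B e ∧ (rN ⁅ e ⁆ ≡ᵇ 0)) ∨ not (lookup B e)) ∧ D⊆loopsᵇ)
  splice-loop-bit e = begin
    (RM.rank⁺ ⁅ e ⁆ ⊓ (RN.rank⁰ ⁅ e ⁆ + a) ≡ᵇ 0)
      ≡⟨ m⊓n≡ᵇ0 (RM.rank⁺ ⁅ e ⁆) (RN.rank⁰ ⁅ e ⁆ + a) ⟩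
    (RM.rank⁺ ⁅ e ⁆ ≡ᵇ 0) ∨ (RN.rank⁰ ⁅ e ⁆ + a ≡ᵇ 0)
      ≡⟨ cong ((RM.rank⁺ ⁅ e ⁆ ≡ᵇ 0) ∨_) (m+n≡ᵇ0 (RN.rank⁰ ⁅ e ⁆) a) ⟩
    (RM.rank⁺ ⁅ e ⁆ ≡ᵇ 0) ∨ ((RN.rank⁰ ⁅ e ⁆ ≡ᵇ 0) ∧ D⊆loopsᵇ)
      ≡⟨ cong₂ (λ u v → u ∨ (v ∧ D⊆loopsᵇ)) (RM.rank⁺-⁅x⁆≡ᵇ0 e) (RN.rank⁰-⁅x⁆≡ᵇ0 e) ⟩
    (lookup A e ∧ (rM ⁅ e ⁆ ≡ᵇ 0)) ∨ (((lookup B e ∧ (rN ⁅ e ⁆ ≡ᵇ 0)) ∨ not (lookup B e)) ∧ D⊆loopsᵇ) ∎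
    where open ≡-Reasoning

  spliceLoops : loopsR S rS ≡ loops M ∪ (if D⊆loopsᵇ then loops N ∪ D else ⊥)
  spliceLoops = lookup-ext λ e → begin
    lookup (loopsR S rS) e
      ≡⟨ lookup-loopsR S rS e ⟩
    lookup S e ∧ (rS ⁅ e ⁆ ≡ᵇ 0)
      ≡⟨ cong₂ _∧_ (lookup-∪ A B e) (splice-loop-bit e) ⟩
    (lookup A e ∨ lookup B e) ∧ (lM e ∨ ((lN e ∨ not (lookup B e)) ∧ D⊆loopsᵇ))
      ≡⟨ regions (lookup A e) (lookup B e) ⟩
    lM e ∨ ((lN e ∨ lookup A e ∧ not (lookup B e)) ∧ D⊆loopsᵇ)
      ≡⟨ cong₂ _∨_ (lookup-loopsR A rM e) (trans (lookup-if D⊆loopsᵇ (loops N ∪ D) e) (cong (_∧ D⊆loopsᵇ)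
           (trans (lookup-∪ (loops N) D e) (cong₂ _∨_ (lookup-loopsR B rN e) (lookup-─ A B e))))) ⟨
    lookup (loops M) e ∨ lookup (if D⊆loopsᵇ then loops N ∪ D else ⊥) e
      ≡⟨ lookup-∪ (loops M) (if D⊆loopsᵇ then loops N ∪ D else ⊥) e ⟨
    lookup (loops M ∪ (if D⊆loopsᵇ then loops N ∪ D else ⊥)) e ∎
    where
    open ≡-Reasoning
    lM lN : Fin n → Bool
    lM e = lookup A e ∧ (rM ⁅ e ⁆ ≡ᵇ 0)
    lN e = lookup B e ∧ (rN ⁅ e ⁆ ≡ᵇ 0)
    regions : ∀ aₑ bₑ {l m} → (aₑ ∨ bₑ) ∧ ((aₑ ∧ l) ∨ (((bₑ ∧ m) ∨ not bₑ) ∧ D⊆loopsᵇ)) ≡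
                             (aₑ ∧ l) ∨ (((bₑ ∧ m) ∨ aₑ ∧ not bₑ) ∧ D⊆loopsᵇ)
    regions true  true  = refl
    regions true  false = refl
    regions false true  = refl
    regions false false = refl

  spliceIsthm : isthmR S rS ≡ (if F⊆isthmᵇ then isthm M else ⊥) ∪ isthm N
  spliceIsthm = lookup-ext λ e → begin
    lookup (isthmR S rS) e
      ≡⟨ lookup-isthmR S rS e ⟩
    lookup S e ∧ (rS (S - e) <ᵇ rS S)
      ≡⟨ cong (_∧ (rS (S - e) <ᵇ rS S)) (lookup-∪ A B e) ⟩
    (lookup A e ∨ lookup B e) ∧ (rS (S - e) <ᵇ rS S)
      ≡⟨ regions e (e ∈? A) (e ∈? B) ⟩
    (iM e ∧ F⊆isthmᵇ) ∨ iN e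
      ≡⟨ cong₂ _∨_ (trans (lookup-if F⊆isthmᵇ (isthm M) e) (cong (_∧ F⊆isthmᵇ) (lookup-isthmR A rM e)))
                   (lookup-isthmR B rN e) ⟨
    lookup (if F⊆isthmᵇ then isthm M else ⊥) e ∨ lookup (isthm N) e
      ≡⟨ lookup-∪ (if F⊆isthmᵇ then isthm M else ⊥) (isthm N) e ⟨
    lookup ((if F⊆isthmᵇ then isthm M else ⊥) ∪ isthm N) e ∎
    where
    open ≡-Reasoning
    iM iN : Fin n → Bool
    iM e = lookup A e ∧ (rM (A - e) <ᵇ rM A)
    iN e = lookup B e ∧ (rN (B - e) <ᵇ rN B)
    regions : ∀ e → Dec (e ∈ A) → Dec (e ∈ B) →
              (lookup A e ∨ lookup B e) ∧ (rS (S - e) <ᵇ rS S) ≡ (iM e ∧ F⊆isthmᵇ) ∨ iN e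
    regions e (yes e∈A) (yes e∈B) rewrite []=⇒lookup e∈A | []=⇒lookup e∈B =
      trans (splice-isthm-bit-∈B e∈B) (sym (∧-∨-absorb _ F⊆isthmᵇ _ λ iMₑ F⊆isthmᵇ≡true →
        Equivalence.from <ᵇ-reflects (isthmM⇒isthmN (Equivalence.to ≤ᵇ-reflects F⊆isthmᵇ≡true) e∈A e∈B
                                                    (Equivalence.to <ᵇ-reflects iMₑ))))
    regions e (yes e∈A) (no e∉B) rewrite []=⇒lookup e∈A | lookup-∉ e∉B =
      trans (splice-isthm-bit-∈D e∈A e∉B) (sym (∨-identityʳ _))
    regions e (no e∉A) (yes e∈B) rewrite lookup-∉ e∉A | []=⇒lookup e∈B = splice-isthm-bit-∈B e∈B
    regions e (no e∉A) (no e∉B) rewrite lookup-∉ e∉A | lookup-∉ e∉B = refl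

  loops-⊆ : D ⊆ loops M → loopsR S rS ≡ loops M ∪ loops N
  loops-⊆ D⊆loops = begin
    loopsR S rS
      ≡⟨ spliceLoops ⟩
    loops M ∪ (if D⊆loopsᵇ then loops N ∪ D else ⊥)
      ≡⟨ cong (λ b → loops M ∪ (if b then loops N ∪ D else ⊥)) D⊆loopsᵇ≡true ⟩
    loops M ∪ (loops N ∪ D)
      ≡⟨ r⊆p⇒p∪[q∪r]≡p∪q D⊆loops ⟩
    loops M ∪ loops N ∎
    where
    open ≡-Reasoning
    D⊆loopsᵇ≡true : D⊆loopsᵇ ≡ true
    D⊆loopsᵇ≡true = Equivalence.from D⊆loopsᵇ-reflects D⊆loops

  loops-⊈ : ¬ D ⊆ loops M → loopsR S rS ≡ loops M
  loops-⊈ D⊈loops = begin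
    loopsR S rS
      ≡⟨ spliceLoops ⟩
    loops M ∪ (if D⊆loopsᵇ then loops N ∪ D else ⊥)
      ≡⟨ cong (λ b → loops M ∪ (if b then loops N ∪ D else ⊥)) D⊆loopsᵇ≡false ⟩
    loops M ∪ ⊥
      ≡⟨ ∪-identityʳ (loops M) ⟩
    loops M ∎
    where
    open ≡-Reasoning
    D⊆loopsᵇ≡false : D⊆loopsᵇ ≡ false
    D⊆loopsᵇ≡false = ¬-not (D⊈loops ∘ Equivalence.to D⊆loopsᵇ-reflects)

  isthm-⊆ : F ⊆ isthm N → isthmR S rS ≡ isthm M ∪ isthm N
  isthm-⊆ F⊆isthm = trans spliceIsthm (cong (λ b → (if b then isthm M else ⊥) ∪ isthm N) F⊆isthmᵇ≡true)
    where
    F⊆isthmᵇ≡true : F⊆isthmᵇ ≡ true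
    F⊆isthmᵇ≡true = Equivalence.from F⊆isthmᵇ-reflects F⊆isthm

  isthm-⊈ : ¬ F ⊆ isthm N → isthmR S rS ≡ isthm N
  isthm-⊈ F⊈isthm = begin
    isthmR S rS
      ≡⟨ spliceIsthm ⟩
    (if F⊆isthmᵇ then isthm M else ⊥) ∪ isthm N
      ≡⟨ cong (λ b → (if b then isthm M else ⊥) ∪ isthm N) F⊆isthmᵇ≡false ⟩
    ⊥ ∪ isthm N
      ≡⟨ ∪-identityˡ (isthm N) ⟩
    isthm N ∎
    where
    open ≡-Reasoning
    F⊆isthmᵇ≡false : F⊆isthmᵇ ≡ false
    F⊆isthmᵇ≡false = ¬-not (F⊈isthm ∘ Equivalence.to F⊆isthmᵇ-reflects)

corollary3p11 : ∀ {n} (M N : Matroid n) → Matched M N →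
    ((ground M ─ ground N ⊆ loops M →
        loopsR (spliceGround M N) (spliceRank M N) ≡ loops M ∪ loops N)
     × (¬ (ground M ─ ground N ⊆ loops M) →
        loopsR (spliceGround M N) (spliceRank M N) ≡ loops M))
    × ((ground N ─ ground M ⊆ isthm N →
        isthmR (spliceGround M N) (spliceRank M N) ≡ isthm M ∪ isthm N)
     × (¬ (ground N ─ ground M ⊆ isthm N) →
        isthmR (spliceGround M N) (spliceRank M N) ≡ isthm N))
corollary3p11 M N matched = (loops-⊆ , loops-⊈) , (isthm-⊆ , isthm-⊈)
  where open FreeSplice M N matched
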